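{- Let $\mathcal{M}=(\mathbb{Z}_n,\mathcal{B})$ be a cyclic $k$-matroid, and for $j\in\mathbb{Z}_n$ let $B_j=\{j,j+1,\ldots,j+k-1\}$ (modulo $n$), so $B_0=\{0,1,\ldots,k-1\}$. Let $Q\subseteq B_0$ be nonempty with $|Q|=r$, let $q_1$ and $q_2$ be the smallest and largest elements of $Q$ (as integers in $\{0,\ldots,k-1\}$), and assume $q_2-q_1<n-k$. Define $$m=\left\lfloor \frac{n-k-q_2+q_1-1}{k-r+1}\right\rfloor+1.$$ Then there exist $m$ distinct bases in $\mathcal{B}$ of the form $(B_0\setminus Q)\cup P_i$, where $i$ is an integer with $q_2-q_1<i\le n-k$ and $P_i\subseteq B_{q_1+i}\setminus B_0$.
   Context: The ground set is $\mathbb{Z}_n=\{0,1,\ldots,n-1\}$ with arithmetic modulo $n$; for $s\in\mathbb{Z}_n$ and $A\subseteq\mathbb{Z}_n$, $s+A=\{s+a:a\in A\}$. A matroid $\mathcal{M}=(\mathbb{Z}_n,\mathcal{B})$ (given by its set of bases $\mathcal{B}$) is a cyclic $k$-matroid if it has rank $k$ and $A\in\mathcal{B}$ implies $s+A\in\mathcal{B}$ for all $s\in\mathbb{Z}_n$. -}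

module Defs where

open import Data.Nat using (ℕ; zero; suc; _+_; _<ᵇ_)
open import Data.Nat.DivMod using (_%_; m%n<n)
open import Data.Fin using (Fin; toℕ; fromℕ<)
open import Data.Fin.Properties using (any?; _≟_)
open import Data.Fin.Subset using (Subset; _∈_; _∉_; _-_; _∪_; ⁅_⁆; ∣_∣)
open import Data.Fin.Subset.Properties using (_∈?_)
open import Data.Vec using (tabulate)
open import Data.Product using (∃; _×_; _,_)
open import Relation.Nullary using (does)
open import Relation.Binary.PropositionalEquality using (_≡_)
open import Relation.Nullary.Decidable using (_×-dec_)

_⊕_ : ∀ {n} → ℕ → Fin n → Fin n
_⊕_ {suc n} s x = fromℕ< (m%n<n (s + toℕ x) (suc n))

shift : ∀ {n} → ℕ → Subset n → Subset n
shift s A = tabulate λ x → does (any? λ a → (a ∈? A) ×-dec (x ≟ (s ⊕ a)))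

B₀ : ∀ {n} → ℕ → Subset n
B₀ k = tabulate λ x → toℕ x <ᵇ k

Bint : ∀ {n} → ℕ → ℕ → Subset n
Bint k j = shift j (B₀ k)

record IsMatroid {n : ℕ} (𝓑 : Subset n → Set) : Set₁ where
  field
    bases-nonempty : ∃ λ B → 𝓑 B
    basis-exchange : ∀ B₁ B₂ → 𝓑 B₁ → 𝓑 B₂ → ∀ x → x ∈ B₁ → x ∉ B₂ →
                     ∃ λ y → y ∈ B₂ × y ∉ B₁ × 𝓑 ((B₁ - x) ∪ ⁅ y ⁆)

record IsCyclicMatroid (n k : ℕ) (𝓑 : Subset n → Set) : Set₁ where
  field
    isMatroid : IsMatroid 𝓑
    rank      : ∀ B → 𝓑 B → ∣ B ∣ ≡ k
    cyclic    : ∀ (s : Fin n) A → 𝓑 A → 𝓑 (shift (toℕ s) A)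

{-# OPTIONS --safe #-}
-- B₀ is a basis of every cyclic k-matroid: given a basis B ⊇ {0,…,j-1} and some x ≥ j in B,
-- augment the independent set {1,…,j} inside B.  If x is dropped, the element exchanged for
-- it must be j; if x survives, rotating the new basis back by one keeps {0,…,j-1} and moves x
-- down, so induction on x - j applies.  Hence B₀ ∖ Q is independent, and augmenting it inside
-- the basis B_{q₁+i} gives a basis (B₀ ∖ Q) ∪ P_i with P_i ⊆ B_{q₁+i} ∖ B₀, because B_{q₁+i}
-- starts beyond q₂ and wraps around only below q₁, so it misses Q.  Every such P_i has at
-- least r elements, whereas if the bases for offsets i + (k - r + 1) ≤ i′ coincided, P_{i′}
-- would lie in the interval [q₁ + i′, q₁ + i + k) of length r - 1.  The offsets
-- d + 1 + j (k - r + 1) ≤ n - k, where d = q₂ - q₁, provide m distinct bases.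

module Submission where

open import Defs
open import Data.Bool using (Bool; T)
open import Data.Bool.Properties using (T-≡)
open import Data.Empty using (⊥-elim)
open import Data.Fin as Fin using (Fin; toℕ; fromℕ<)
open import Data.Fin.Properties using (toℕ-fromℕ<; toℕ-injective; toℕ<n; any?; _≟_)
open import Data.Fin.Subset using (Subset; _∈_; _∉_; _⊆_; _⊂_; _─_; _-_; _∪_; ⁅_⁆; ∣_∣; inside; outside)
open import Data.Fin.Subset.Properties
open import Data.Nat using (ℕ; zero; suc; _≤_; _<_; _∸_; _+_; _*_; z≤n; s≤s; z<s; s<s; s≤s⁻¹; s<s⁻¹; _<?_; _≤?_)
open import Data.Nat.DivMod using (_/_; _%_; m<n⇒m%n≡m; [m+n]%n≡m%n; m/n*n≤m)
open import Data.Nat.Properties hiding (_≟_)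
open import Data.Product using (∃; _×_; _,_; proj₁; proj₂)
open import Data.Sum using (_⊎_; inj₁; inj₂; [_,_]′)
open import Data.Vec using (_∷_; []; tabulate; here; there)
open import Data.Vec.Properties using (lookup∘tabulate; []=⇒lookup; lookup⇒[]=)
open import Function using (id; _∘_; Equivalence)
open import Function.Definitions using (Injective)
open import Relation.Binary using (tri<; tri≈; tri>)
open import Relation.Binary.PropositionalEquality using (_≡_; _≢_; refl; sym; trans; cong; subst; module ≡-Reasoning)
open import Relation.Nullary using (Dec; yes; no)
open import Relation.Nullary.Decidable using (toWitness; fromWitness; _×-dec_; isYes≗does)

x∈p─q⁻ : ∀ {n} (p q : Subset n) {x} → x ∈ p ─ q → x ∈ p × x ∉ q
x∈p─q⁻ (_ ∷ p) (inside  ∷ q) {Fin.zero} ()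
x∈p─q⁻ (_ ∷ p) (outside ∷ q) {Fin.zero} here = here , λ ()
x∈p─q⁻ (_ ∷ p) (_       ∷ q) {Fin.suc _} (there x∈p─q) with x∈p─q⁻ p q x∈p─q
... | x∈p , x∉q = there x∈p , λ { (there x∈q) → x∉q x∈q }

x∈[p-y]∪⁅z⁆⁻ : ∀ {n} (p : Subset n) y z {x} → x ∈ (p - y) ∪ ⁅ z ⁆ → (x ∈ p × x ≢ y) ⊎ x ≡ z
x∈[p-y]∪⁅z⁆⁻ p y z x∈ with x∈p∪q⁻ (p - y) ⁅ z ⁆ x∈
... | inj₁ x∈p-y = let x∈p , x∉y = x∈p─q⁻ p ⁅ y ⁆ x∈p-y in inj₁ (x∈p , x∉⁅y⁆⇒x≢y x∉y)
... | inj₂ x∈z   = inj₂ (x∈⁅y⁆⇒x≡y z x∈z)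

∣p∪q∣≤∣p∣+∣q∣ : ∀ {n} (p q : Subset n) → ∣ p ∪ q ∣ ≤ ∣ p ∣ + ∣ q ∣
∣p∪q∣≤∣p∣+∣q∣ []            []            = z≤n
∣p∪q∣≤∣p∣+∣q∣ (inside  ∷ p) (inside  ∷ q) = s≤s (≤-trans (∣p∪q∣≤∣p∣+∣q∣ p q) (+-monoʳ-≤ ∣ p ∣ (n≤1+n ∣ q ∣)))
∣p∪q∣≤∣p∣+∣q∣ (inside  ∷ p) (outside ∷ q) = s≤s (∣p∪q∣≤∣p∣+∣q∣ p q)
∣p∪q∣≤∣p∣+∣q∣ (outside ∷ p) (inside  ∷ q) = ≤-trans (s≤s (∣p∪q∣≤∣p∣+∣q∣ p q)) (≤-reflexive (sym (+-suc ∣ p ∣ ∣ q ∣)))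
∣p∪q∣≤∣p∣+∣q∣ (outside ∷ p) (outside ∷ q) = ∣p∪q∣≤∣p∣+∣q∣ p q

∣p─q∣+∣q∣≡∣p∪q∣ : ∀ {n} (p q : Subset n) → ∣ p ─ q ∣ + ∣ q ∣ ≡ ∣ p ∪ q ∣
∣p─q∣+∣q∣≡∣p∪q∣ []            []            = refl
∣p─q∣+∣q∣≡∣p∪q∣ (inside  ∷ p) (inside  ∷ q) = trans (+-suc _ _) (cong suc (∣p─q∣+∣q∣≡∣p∪q∣ p q))
∣p─q∣+∣q∣≡∣p∪q∣ (inside  ∷ p) (outside ∷ q) = cong suc (∣p─q∣+∣q∣≡∣p∪q∣ p q)
∣p─q∣+∣q∣≡∣p∪q∣ (outside ∷ p) (inside  ∷ q) = trans (+-suc _ _) (cong suc (∣p─q∣+∣q∣≡∣p∪q∣ p q))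
∣p─q∣+∣q∣≡∣p∪q∣ (outside ∷ p) (outside ∷ q) = ∣p─q∣+∣q∣≡∣p∪q∣ p q

q⊆p⇒∣p─q∣+∣q∣≡∣p∣ : ∀ {n} {p q : Subset n} → q ⊆ p → ∣ p ─ q ∣ + ∣ q ∣ ≡ ∣ p ∣
q⊆p⇒∣p─q∣+∣q∣≡∣p∣ {p = p} {q} q⊆p =
  trans (∣p─q∣+∣q∣≡∣p∪q∣ p q) (cong ∣_∣ (⊆-antisym (λ x∈ → [ id , q⊆p ]′ (x∈p∪q⁻ p q x∈)) (p⊆p∪q q)))

p⊆q⇒∣q∣≤∣p∣⇒p≡q : ∀ {n} {p q : Subset n} → p ⊆ q → ∣ q ∣ ≤ ∣ p ∣ → p ≡ q
p⊆q⇒∣q∣≤∣p∣⇒p≡q {p = p} p⊆q ∣q∣≤∣p∣ = ⊆-antisym p⊆q q⊆p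
  where
  q⊆p : _ ⊆ p
  q⊆p {x} x∈q with x ∈? p
  ... | yes x∈p = x∈p
  ... | no  x∉p = ⊥-elim (<⇒≱ (p⊂q⇒∣p∣<∣q∣ (p⊆q , x , x∈q , x∉p)) ∣q∣≤∣p∣)

within-interval⇒∣p∣≤l : ∀ {n} (p : Subset n) a l → (∀ {x} → x ∈ p → a ≤ toℕ x × toℕ x < a + l) → ∣ p ∣ ≤ l
within-interval⇒∣p∣≤l []            _       _       _      = z≤n
within-interval⇒∣p∣≤l (inside  ∷ p) zero    zero    bounds with () ← proj₂ (bounds here)
within-interval⇒∣p∣≤l (inside  ∷ p) zero    (suc l) bounds =
  s≤s (within-interval⇒∣p∣≤l p 0 l λ x∈p → z≤n , s<s⁻¹ (proj₂ (bounds (there x∈p))))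
within-interval⇒∣p∣≤l (inside  ∷ p) (suc a) l       bounds with () ← proj₁ (bounds here)
within-interval⇒∣p∣≤l (outside ∷ p) zero    l       bounds =
  within-interval⇒∣p∣≤l p 0 l λ x∈p → z≤n , <-trans (n<1+n _) (proj₂ (bounds (there x∈p)))
within-interval⇒∣p∣≤l (outside ∷ p) (suc a) l       bounds =
  within-interval⇒∣p∣≤l p a l λ x∈p → let a≤x , x<a+l = bounds (there x∈p) in s≤s⁻¹ a≤x , s<s⁻¹ x<a+l

r≡[p─q]∪[r─p] : ∀ {n} {p q r w : Subset n} → (∀ {x} → x ∈ w → x ∉ q) →
                p ─ q ⊆ r → r ⊆ (p ─ q) ∪ w → r ≡ (p ─ q) ∪ (r ─ p)
r≡[p─q]∪[r─p] {p = p} {q} {r} {w} w∩q≡∅ p─q⊆r r⊆[p─q]∪w = ⊆-antisym r⊆ ⊆r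
  where
  r⊆ : r ⊆ (p ─ q) ∪ (r ─ p)
  r⊆ {x} x∈r with x ∈? p
  ... | no  x∉p = q⊆p∪q (p ─ q) (r ─ p) (x∈p∧x∉q⇒x∈p─q x∈r x∉p)
  ... | yes x∈p = p⊆p∪q (r ─ p) (x∈p∧x∉q⇒x∈p─q x∈p x∉q)
    where
    x∉q : x ∉ q
    x∉q = [ proj₂ ∘ x∈p─q⁻ p q , w∩q≡∅ ]′ (x∈p∪q⁻ (p ─ q) w (r⊆[p─q]∪w x∈r))
  ⊆r : (p ─ q) ∪ (r ─ p) ⊆ r
  ⊆r x∈ = [ p─q⊆r , proj₁ ∘ x∈p─q⁻ r p ]′ (x∈p∪q⁻ (p ─ q) (r ─ p) x∈)

r⊆[p─q]∪w⇒r─p⊆w─p : ∀ {n} {p q r w : Subset n} → r ⊆ (p ─ q) ∪ w → r ─ p ⊆ w ─ p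
r⊆[p─q]∪w⇒r─p⊆w─p {p = p} {q} {r} {w} r⊆[p─q]∪w x∈ with x∈p─q⁻ r p x∈
... | x∈r , x∉p with x∈p∪q⁻ (p ─ q) w (r⊆[p─q]∪w x∈r)
...   | inj₁ x∈p─q = ⊥-elim (x∉p (p─q⊆p p q x∈p─q))
...   | inj₂ x∈w   = x∈p∧x∉q⇒x∈p─q x∈w x∉p

toℕ-⊕ : ∀ {n} s (x : Fin (suc n)) → toℕ (s ⊕ x) ≡ (s + toℕ x) % suc n
toℕ-⊕ s x = toℕ-fromℕ< _

toℕ-⊕-nowrap : ∀ {n} s (x : Fin n) → s + toℕ x < n → toℕ (s ⊕ x) ≡ s + toℕ x
toℕ-⊕-nowrap {suc n} s x s+x<n = trans (toℕ-⊕ s x) (m<n⇒m%n≡m s+x<n)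

toℕ-⊕-wrap : ∀ {n} s (x : Fin n) {t} → s + toℕ x ≡ t + n → t < n → toℕ (s ⊕ x) ≡ t
toℕ-⊕-wrap {suc n} s x {t} s+x≡t+n t<n = begin
  toℕ (s ⊕ x)          ≡⟨ toℕ-⊕ s x ⟩
  (s + toℕ x) % suc n  ≡⟨ cong (_% suc n) s+x≡t+n ⟩
  (t + suc n) % suc n  ≡⟨ [m+n]%n≡m%n t (suc n) ⟩
  t % suc n            ≡⟨ m<n⇒m%n≡m t<n ⟩
  t                    ∎
  where open ≡-Reasoning

toℕ-pred⊕ : ∀ {n m} {z : Fin n} → suc m ≡ toℕ z → toℕ ((n ∸ 1) ⊕ z) ≡ m
toℕ-pred⊕ {suc n} {m} {z} 1+m≡z = toℕ-⊕-wrap n z n+z≡m+1+n (<⇒≤ (subst (_< suc n) (sym 1+m≡z) (toℕ<n z)))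
  where
  n+z≡m+1+n : n + toℕ z ≡ m + suc n
  n+z≡m+1+n = begin
    n + toℕ z    ≡⟨ cong (n +_) (sym 1+m≡z) ⟩
    n + suc m    ≡⟨ +-comm n (suc m) ⟩
    suc (m + n)  ≡⟨ sym (+-suc m n) ⟩
    m + suc n    ∎
    where open ≡-Reasoning

-- Literally the decision procedure in the definition of shift, so that the two agree definitionally.
shifted? : ∀ {n} s (A : Subset n) x → Dec (∃ λ a → a ∈ A × x ≡ s ⊕ a)
shifted? s A x = any? λ a → (a ∈? A) ×-dec (x ≟ s ⊕ a)

∈tabulate⁺ : ∀ {n} {f : Fin n → Bool} {x} → T (f x) → x ∈ tabulate f
∈tabulate⁺ {f = f} {x} fx = lookup⇒[]= x _ (trans (lookup∘tabulate f x) (Equivalence.to T-≡ fx))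

∈tabulate⁻ : ∀ {n} {f : Fin n → Bool} {x} → x ∈ tabulate f → T (f x)
∈tabulate⁻ {f = f} {x} x∈ = Equivalence.from T-≡ (trans (sym (lookup∘tabulate f x)) ([]=⇒lookup x∈))

∈B₀⁺ : ∀ {n} k {x : Fin n} → toℕ x < k → x ∈ B₀ k
∈B₀⁺ k = ∈tabulate⁺ ∘ <⇒<ᵇ

∈B₀⁻ : ∀ {n} k {x : Fin n} → x ∈ B₀ k → toℕ x < k
∈B₀⁻ k {x} = <ᵇ⇒< (toℕ x) k ∘ ∈tabulate⁻

∣B₀∣ : ∀ {n} k → k ≤ n → ∣ B₀ {n} k ∣ ≡ k
∣B₀∣ {zero}  zero    _         = refl
∣B₀∣ {suc n} zero    _         = ∣B₀∣ {n} zero z≤n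
∣B₀∣ {suc n} (suc k) (s≤s k≤n) = cong suc (∣B₀∣ {n} k k≤n)

∈shift⁺ : ∀ {n} s {A : Subset n} {a} → a ∈ A → s ⊕ a ∈ shift s A
∈shift⁺ s {A} {a} a∈A =
  ∈tabulate⁺ (subst T (isYes≗does (shifted? s A (s ⊕ a))) (fromWitness (a , a∈A , refl)))

∈shift⁻ : ∀ {n} s {A : Subset n} {x} → x ∈ shift s A → ∃ λ a → a ∈ A × x ≡ s ⊕ a
∈shift⁻ s {A} {x} x∈ = toWitness (subst T (sym (isYes≗does (shifted? s A x))) (∈tabulate⁻ x∈))

shift-mono : ∀ {n} s {A A′ : Subset n} → A ⊆ A′ → shift s A ⊆ shift s A′
shift-mono s A⊆A′ x∈ with ∈shift⁻ s x∈
... | a , a∈A , refl = ∈shift⁺ s (A⊆A′ a∈A)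

∈B₀-suc⁻ : ∀ {n} j {w : Fin n} → w ∈ B₀ (suc j) → w ∈ B₀ j ⊎ toℕ w ≡ j
∈B₀-suc⁻ j w∈ with m<1+n⇒m<n∨m≡n (∈B₀⁻ (suc j) w∈)
... | inj₁ w<j = inj₁ (∈B₀⁺ j w<j)
... | inj₂ w≡j = inj₂ w≡j

∈Bint⁺ : ∀ {n} k s {z : Fin n} → s ≤ toℕ z → toℕ z < s + k → z ∈ Bint k s
∈Bint⁺ {n} k s {z} s≤z z<s+k = subst (_∈ Bint k s) s⊕a≡z (∈shift⁺ s (∈B₀⁺ k a<k))
  where
  z∸s<n : toℕ z ∸ s < n
  z∸s<n = ≤-<-trans (m∸n≤m (toℕ z) s) (toℕ<n z)
  a : Fin n
  a = fromℕ< z∸s<n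
  s+a≡z : s + toℕ a ≡ toℕ z
  s+a≡z = trans (cong (s +_) (toℕ-fromℕ< z∸s<n)) (m+[n∸m]≡n s≤z)
  a<k : toℕ a < k
  a<k = +-cancelˡ-< s (toℕ a) k (subst (_< s + k) (sym s+a≡z) z<s+k)
  s⊕a≡z : s ⊕ a ≡ z
  s⊕a≡z = toℕ-injective (trans (toℕ-⊕-nowrap s a (subst (_< n) (sym s+a≡z) (toℕ<n z))) s+a≡z)

∈Bint⁻ : ∀ {n} k s {z : Fin n} → s < n → z ∈ Bint k s →
         (s ≤ toℕ z × toℕ z < s + k) ⊎ toℕ z + n < s + k
∈Bint⁻ {n} k s s<n z∈ with ∈shift⁻ s z∈
... | a , a∈B₀ , refl with s + toℕ a <? n
...   | yes s+a<n = inj₁ (subst (s ≤_) (sym s⊕a≡s+a) (m≤m+n s (toℕ a)) ,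
                          subst (_< s + k) (sym s⊕a≡s+a) (+-monoʳ-< s (∈B₀⁻ k a∈B₀)))
  where
  s⊕a≡s+a : toℕ (s ⊕ a) ≡ s + toℕ a
  s⊕a≡s+a = toℕ-⊕-nowrap s a s+a<n
...   | no  s+a≮n = inj₂ (subst (_< s + k) (sym s⊕a+n≡s+a) (+-monoʳ-< s (∈B₀⁻ k a∈B₀)))
  where
  n≤s+a : n ≤ s + toℕ a
  n≤s+a = ≮⇒≥ s+a≮n
  s+a≡t+n : s + toℕ a ≡ (s + toℕ a ∸ n) + n
  s+a≡t+n = sym (m∸n+n≡m n≤s+a)
  t<n : s + toℕ a ∸ n < n
  t<n = +-cancelʳ-< n _ n (subst (_< n + n) s+a≡t+n (+-mono-< s<n (toℕ<n a)))
  s⊕a+n≡s+a : toℕ (s ⊕ a) + n ≡ s + toℕ a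
  s⊕a+n≡s+a = trans (cong (_+ n) (toℕ-⊕-wrap s a s+a≡t+n t<n)) (sym s+a≡t+n)

B₀⊆shift[n∸1] : ∀ {n j} {A : Subset n} → j < n → Bint j 1 ⊆ A → B₀ j ⊆ shift (n ∸ 1) A
B₀⊆shift[n∸1] {n} {j} {A} j<n Bint⊆A {w} w∈B₀ = subst (_∈ shift (n ∸ 1) A) pred⊕z≡w (∈shift⁺ (n ∸ 1) (Bint⊆A z∈Bint))
  where
  1+w<n : suc (toℕ w) < n
  1+w<n = ≤-<-trans (∈B₀⁻ j w∈B₀) j<n
  z : Fin n
  z = fromℕ< 1+w<n
  z≡1+w : toℕ z ≡ suc (toℕ w)
  z≡1+w = toℕ-fromℕ< 1+w<n
  z∈Bint : z ∈ Bint j 1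
  z∈Bint = ∈Bint⁺ j 1 (subst (1 ≤_) (sym z≡1+w) (s≤s z≤n)) (subst (_< suc j) (sym z≡1+w) (s<s (∈B₀⁻ j w∈B₀)))
  pred⊕z≡w : (n ∸ 1) ⊕ z ≡ w
  pred⊕z≡w = toℕ-injective (toℕ-pred⊕ (sym z≡1+w))

module MatroidProperties {n} {𝓑 : Subset n → Set} (M : IsMatroid 𝓑) where
  open IsMatroid M

  Independent : Subset n → Set
  Independent I = ∃ λ B → 𝓑 B × I ⊆ B

  exchange-outside : ∀ {I B B₁} → 𝓑 B → 𝓑 B₁ → I ⊆ B₁ → ∀ {x} → x ∈ B₁ ─ (I ∪ B) →
                     ∃ λ B₂ → 𝓑 B₂ × I ⊆ B₂ × B₂ ─ (I ∪ B) ⊂ B₁ ─ (I ∪ B)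
  exchange-outside {I} {B} {B₁} b b₁ I⊆B₁ {x} x∈ =
    B₂ , b₂ , I⊆B₂ , (outside⊆ , x , x∈ , x∉outside₂)
    where
    x∈B₁ : x ∈ B₁
    x∈B₁ = proj₁ (x∈p─q⁻ B₁ (I ∪ B) x∈)
    x∉I∪B : x ∉ I ∪ B
    x∉I∪B = proj₂ (x∈p─q⁻ B₁ (I ∪ B) x∈)
    x∉B : x ∉ B
    x∉B = x∉I∪B ∘ q⊆p∪q I B
    exchanged : ∃ λ y → y ∈ B × y ∉ B₁ × 𝓑 ((B₁ - x) ∪ ⁅ y ⁆)
    exchanged = basis-exchange B₁ B b₁ b x x∈B₁ x∉B
    y : Fin n
    y = proj₁ exchanged
    y∈B : y ∈ B
    y∈B = proj₁ (proj₂ exchanged)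
    B₂ : Subset n
    B₂ = (B₁ - x) ∪ ⁅ y ⁆
    b₂ : 𝓑 B₂
    b₂ = proj₂ (proj₂ (proj₂ exchanged))
    I⊆B₂ : I ⊆ B₂
    I⊆B₂ z∈I = p⊆p∪q ⁅ y ⁆ (x∈p∧x≢y⇒x∈p-y (I⊆B₁ z∈I) λ { refl → x∉I∪B (p⊆p∪q B z∈I) })
    outside⊆ : B₂ ─ (I ∪ B) ⊆ B₁ ─ (I ∪ B)
    outside⊆ z∈ with x∈p─q⁻ B₂ (I ∪ B) z∈
    ... | z∈B₂ , z∉I∪B with x∈[p-y]∪⁅z⁆⁻ B₁ x y z∈B₂
    ...   | inj₁ (z∈B₁ , _) = x∈p∧x∉q⇒x∈p─q z∈B₁ z∉I∪B
    ...   | inj₂ refl       = ⊥-elim (z∉I∪B (q⊆p∪q I B y∈B))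
    x∉outside₂ : x ∉ B₂ ─ (I ∪ B)
    x∉outside₂ x∈₂ with x∈[p-y]∪⁅z⁆⁻ B₁ x y (proj₁ (x∈p─q⁻ B₂ (I ∪ B) x∈₂))
    ... | inj₁ (_ , x≢x) = x≢x refl
    ... | inj₂ x≡y       = x∉B (subst (_∈ B) (sym x≡y) y∈B)

  augment : ∀ {I B} → Independent I → 𝓑 B → ∃ λ B′ → 𝓑 B′ × I ⊆ B′ × B′ ⊆ I ∪ B
  augment {I} {B} (B₁ , b₁ , I⊆B₁) b = go (suc ∣ B₁ ─ (I ∪ B) ∣) b₁ I⊆B₁ ≤-refl
    where
    go : ∀ bound {B₁} → 𝓑 B₁ → I ⊆ B₁ → ∣ B₁ ─ (I ∪ B) ∣ < bound →
         ∃ λ B′ → 𝓑 B′ × I ⊆ B′ × B′ ⊆ I ∪ B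
    go (suc bound) {B₁} b₁ I⊆B₁ _ with nonempty? (B₁ ─ (I ∪ B))
    go (suc bound) {B₁} b₁ I⊆B₁ _ | no nothing-outside = B₁ , b₁ , I⊆B₁ , B₁⊆I∪B
      where
      B₁⊆I∪B : B₁ ⊆ I ∪ B
      B₁⊆I∪B {z} z∈B₁ with z ∈? (I ∪ B)
      ... | yes z∈I∪B = z∈I∪B
      ... | no  z∉I∪B = ⊥-elim (nothing-outside (z , x∈p∧x∉q⇒x∈p─q z∈B₁ z∉I∪B))
    go (suc bound) b₁ I⊆B₁ <bound | yes (x , x∈) with exchange-outside b b₁ I⊆B₁ x∈
    ... | B₂ , b₂ , I⊆B₂ , B₂⊂B₁ = go bound b₂ I⊆B₂ (<-≤-trans (p⊂q⇒∣p∣<∣q∣ B₂⊂B₁) (s≤s⁻¹ <bound))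

module CyclicMatroidProperties {n k} {𝓑 : Subset n → Set} (C : IsCyclicMatroid n k 𝓑) where
  open IsCyclicMatroid C
  open IsMatroid isMatroid
  open MatroidProperties isMatroid public

  shift-basis : ∀ {s A} → s < n → 𝓑 A → 𝓑 (shift s A)
  shift-basis {s} {A} s<n b = subst (λ t → 𝓑 (shift t A)) (toℕ-fromℕ< s<n) (cyclic (fromℕ< s<n) A b)

  shift-independent : ∀ {s I} → s < n → Independent I → Independent (shift s I)
  shift-independent {s} s<n (B , b , I⊆B) = shift s B , shift-basis s<n b , shift-mono s I⊆B

  B₀-extend-by-exchange : ∀ {j B B′ x} → suc j < n → 𝓑 B → 𝓑 B′ → B₀ j ⊆ B → B′ ⊆ Bint j 1 ∪ B →
                          x ∈ B → x ∉ B′ → j < toℕ x → Independent (B₀ (suc j))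
  B₀-extend-by-exchange {j} {B} {B′} {x} 1+j<n b b′ B₀⊆B B′⊆Bint∪B x∈B x∉B′ j<x =
    (B - x) ∪ ⁅ y ⁆ , b″ , B₀[1+j]⊆
    where
    exchanged : ∃ λ y → y ∈ B′ × y ∉ B × 𝓑 ((B - x) ∪ ⁅ y ⁆)
    exchanged = basis-exchange B B′ b b′ x x∈B x∉B′
    y : Fin n
    y = proj₁ exchanged
    y∉B : y ∉ B
    y∉B = proj₁ (proj₂ (proj₂ exchanged))
    b″ : 𝓑 ((B - x) ∪ ⁅ y ⁆)
    b″ = proj₂ (proj₂ (proj₂ exchanged))
    y∈Bint : y ∈ Bint j 1
    y∈Bint = [ id , ⊥-elim ∘ y∉B ]′ (x∈p∪q⁻ (Bint j 1) B (B′⊆Bint∪B (proj₁ (proj₂ exchanged))))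
    y≡j : toℕ y ≡ j
    y≡j with ∈Bint⁻ j 1 (≤-<-trans (s≤s z≤n) 1+j<n) y∈Bint
    ... | inj₂ y+n<1+j = ⊥-elim (<⇒≱ y+n<1+j (≤-trans (<⇒≤ 1+j<n) (m≤n+m n (toℕ y))))
    ... | inj₁ (_ , y<1+j) with m<1+n⇒m<n∨m≡n y<1+j
    ...   | inj₁ y<j = ⊥-elim (y∉B (B₀⊆B (∈B₀⁺ j y<j)))
    ...   | inj₂ y≡j = y≡j
    B₀[1+j]⊆ : B₀ (suc j) ⊆ (B - x) ∪ ⁅ y ⁆
    B₀[1+j]⊆ w∈ with ∈B₀-suc⁻ j w∈
    ... | inj₁ w∈B₀ = p⊆p∪q ⁅ y ⁆ (x∈p∧x≢y⇒x∈p-y (B₀⊆B w∈B₀) λ { refl → <-asym j<x (∈B₀⁻ j w∈B₀) })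
    ... | inj₂ w≡j  = q⊆p∪q (B - x) ⁅ y ⁆ (subst (_∈ ⁅ y ⁆) (toℕ-injective (trans y≡j (sym w≡j))) (x∈⁅x⁆ y))

  B₀-extend-from : ∀ {j} → suc j < n → ∀ t {B} → 𝓑 B → B₀ j ⊆ B → ∀ {x} → x ∈ B → toℕ x ≡ j + t →
                   Independent (B₀ (suc j))
  B₀-extend-from {j} _ zero {B} b B₀⊆B {x} x∈B x≡j+0 = B , b , B₀[1+j]⊆B
    where
    B₀[1+j]⊆B : B₀ (suc j) ⊆ B
    B₀[1+j]⊆B w∈ with ∈B₀-suc⁻ j w∈
    ... | inj₁ w∈B₀ = B₀⊆B w∈B₀
    ... | inj₂ w≡j  = subst (_∈ B) (toℕ-injective (trans x≡j+0 (trans (+-identityʳ j) (sym w≡j)))) x∈B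
  B₀-extend-from {j} 1+j<n (suc t) {B} b B₀⊆B {x} x∈B x≡j+1+t
    with augment (shift-independent (≤-<-trans (s≤s z≤n) 1+j<n) (B , b , B₀⊆B)) b
  ... | B′ , b′ , Bint⊆B′ , B′⊆Bint∪B with x ∈? B′
  ...   | yes x∈B′ = B₀-extend-from 1+j<n t (shift-basis (∸-monoʳ-< z<s (≤-trans (s≤s z≤n) 1+j<n)) b′)
                       (B₀⊆shift[n∸1] (<-trans (n<1+n j) 1+j<n) Bint⊆B′) (∈shift⁺ (n ∸ 1) x∈B′)
                       (toℕ-pred⊕ (sym (trans x≡j+1+t (+-suc j t))))
  ...   | no  x∉B′ = B₀-extend-by-exchange 1+j<n b b′ B₀⊆B B′⊆Bint∪B x∈B x∉B′
                       (subst (j <_) (sym x≡j+1+t) (m<m+n j z<s))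

  module _ (k<n : k < n) where

    B₀-extend : ∀ {j} → j < k → Independent (B₀ j) → Independent (B₀ (suc j))
    B₀-extend {j} j<k (B , b , B₀⊆B) with any? (λ x → (x ∈? B) ×-dec (j ≤? toℕ x))
    ... | yes (x , x∈B , j≤x) = B₀-extend-from (<-≤-trans (s≤s j<k) k<n) (toℕ x ∸ j) b B₀⊆B x∈B (sym (m+[n∸m]≡n j≤x))
    ... | no  ∄x = ⊥-elim (<⇒≱ j<k (subst (_≤ j) (rank B b) (within-interval⇒∣p∣≤l B 0 j below-j)))
      where
      below-j : ∀ {x} → x ∈ B → 0 ≤ toℕ x × toℕ x < j
      below-j x∈B = z≤n , ≰⇒> λ j≤x → ∄x (_ , x∈B , j≤x)

    B₀-independent : ∀ {j} → j ≤ k → Independent (B₀ j)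
    B₀-independent {zero}  _     = proj₁ bases-nonempty , proj₂ bases-nonempty , λ w∈ → ⊥-elim (n≮0 (∈B₀⁻ 0 w∈))
    B₀-independent {suc j} 1+j≤k = B₀-extend 1+j≤k (B₀-independent (<⇒≤ 1+j≤k))

    B₀-basis : 𝓑 (B₀ k)
    B₀-basis with B₀-independent ≤-refl
    ... | B , b , B₀⊆B = subst 𝓑 (sym (p⊆q⇒∣q∣≤∣p∣⇒p≡q B₀⊆B ∣B∣≤∣B₀∣)) b
      where
      ∣B∣≤∣B₀∣ : ∣ B ∣ ≤ ∣ B₀ {n} k ∣
      ∣B∣≤∣B₀∣ = ≤-reflexive (trans (rank B b) (sym (∣B₀∣ {n} k (<⇒≤ k<n))))

suc[m∸n]+[n∸1]≡m : ∀ {m n} → 0 < n → n ≤ m → suc (m ∸ n) + (n ∸ 1) ≡ m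
suc[m∸n]+[n∸1]≡m {m} {suc n} _ 1+n≤m = trans (sym (+-suc (m ∸ suc n) n)) (m∸n+n≡m 1+n≤m)

module Windows {n k} {𝓑 : Subset n → Set} (C : IsCyclicMatroid n k 𝓑) (k<n : k < n)
               {Q : Subset n} {q₁ q₂ : Fin n} (Q⊆B₀ : Q ⊆ B₀ k) (q₁∈Q : q₁ ∈ Q)
               (Q-bounds : ∀ q → q ∈ Q → toℕ q₁ ≤ toℕ q × toℕ q ≤ toℕ q₂) where
  open IsCyclicMatroid C using (rank)
  open CyclicMatroidProperties C

  d : ℕ
  d = toℕ q₂ ∸ toℕ q₁

  r : ℕ
  r = ∣ Q ∣

  c : ℕ
  c = suc (k ∸ r)

  I : Subset n
  I = B₀ k ─ Q

  q₁<k : toℕ q₁ < k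
  q₁<k = ∈B₀⁻ k (Q⊆B₀ q₁∈Q)

  ∣I∣+r≡k : ∣ I ∣ + r ≡ k
  ∣I∣+r≡k = trans (q⊆p⇒∣p─q∣+∣q∣≡∣p∣ Q⊆B₀) (rank (B₀ k) (B₀-basis k<n))

  0<r : 0 < r
  0<r = subst (_≤ r) (∣⁅x⁆∣≡1 q₁) (p⊆q⇒∣p∣≤∣q∣ λ x∈ → subst (_∈ Q) (sym (x∈⁅y⁆⇒x≡y q₁ x∈)) q₁∈Q)

  L : ℕ
  L = n ∸ k ∸ d ∸ 1

  offset : ℕ → ℕ
  offset j = suc d + j * c

  d<offset : ∀ j → d < offset j
  d<offset j = s≤s (m≤m+n d (j * c))

  offset≤n∸k : d < n ∸ k → ∀ {j} → j ≤ L / c → offset j ≤ n ∸ k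
  offset≤n∸k d<n∸k {j} j≤L/c = begin
    suc d + j * c            ≤⟨ +-monoʳ-≤ (suc d) (*-monoˡ-≤ c j≤L/c) ⟩
    suc d + L / c * c        ≤⟨ +-monoʳ-≤ (suc d) (m/n*n≤m L c) ⟩
    suc d + L                ≡⟨ cong (suc d +_) (trans (∸-+-assoc (n ∸ k) d 1) (cong (n ∸ k ∸_) (+-comm d 1))) ⟩
    suc d + (n ∸ k ∸ suc d)  ≡⟨ m+[n∸m]≡n d<n∸k ⟩
    n ∸ k                    ∎
    where open ≤-Reasoning

  offset-gap : ∀ {j j′} → j < j′ → offset j + c ≤ offset j′
  offset-gap {j} {j′} j<j′ = begin
    suc d + j * c + c    ≡⟨ +-assoc (suc d) (j * c) c ⟩
    suc d + (j * c + c)  ≡⟨ cong (suc d +_) (+-comm (j * c) c) ⟩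
    suc d + suc j * c    ≤⟨ +-monoʳ-≤ (suc d) (*-monoˡ-≤ c j<j′) ⟩
    suc d + j′ * c       ∎
    where open ≤-Reasoning

  module Window (i : ℕ) (d<i : d < i) (i≤n∸k : i ≤ n ∸ k) where
    s : ℕ
    s = toℕ q₁ + i

    W : Subset n
    W = Bint k s

    s<n : s < n
    s<n = subst (s <_) (m+[n∸m]≡n (<⇒≤ k<n)) (+-mono-<-≤ q₁<k i≤n∸k)

    s+k≤q₁+n : s + k ≤ toℕ q₁ + n
    s+k≤q₁+n = begin
      toℕ q₁ + i + k        ≡⟨ +-assoc (toℕ q₁) i k ⟩
      toℕ q₁ + (i + k)      ≤⟨ +-monoʳ-≤ (toℕ q₁) (+-monoˡ-≤ k i≤n∸k) ⟩
      toℕ q₁ + (n ∸ k + k)  ≡⟨ cong (toℕ q₁ +_) (m∸n+n≡m (<⇒≤ k<n)) ⟩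
      toℕ q₁ + n            ∎
      where open ≤-Reasoning

    ∈W⁻ : ∀ {y} → y ∈ W → toℕ y < toℕ q₁ ⊎ (s ≤ toℕ y × toℕ y < s + k)
    ∈W⁻ {y} y∈W with ∈Bint⁻ k s s<n y∈W
    ... | inj₁ in-range  = inj₂ in-range
    ... | inj₂ y+n<s+k = inj₁ (+-cancelʳ-< n (toℕ y) (toℕ q₁) (<-≤-trans y+n<s+k s+k≤q₁+n))

    W∩Q≡∅ : ∀ {y} → y ∈ W → y ∉ Q
    W∩Q≡∅ {y} y∈W y∈Q with ∈W⁻ y∈W
    ... | inj₁ y<q₁     = <⇒≱ y<q₁ (proj₁ (Q-bounds y y∈Q))
    ... | inj₂ (s≤y , _) = <⇒≱ (≤-<-trans (proj₂ (Q-bounds y y∈Q)) q₂<s) s≤y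
      where
      q₂<s : toℕ q₂ < s
      q₂<s = subst (_< s) (m+[n∸m]≡n (proj₂ (Q-bounds q₁ q₁∈Q))) (+-monoʳ-< (toℕ q₁) d<i)

    W─B₀-range : ∀ {y} → y ∈ W ─ B₀ k → s ≤ toℕ y × toℕ y < s + k
    W─B₀-range y∈ with x∈p─q⁻ W (B₀ k) y∈
    ... | y∈W , y∉B₀ with ∈W⁻ y∈W
    ...   | inj₁ y<q₁    = ⊥-elim (y∉B₀ (∈B₀⁺ k (<-trans y<q₁ q₁<k)))
    ...   | inj₂ in-range = in-range

    augmented : ∃ λ B → 𝓑 B × I ⊆ B × B ⊆ I ∪ W
    augmented = augment (B₀ k , B₀-basis k<n , p─q⊆p (B₀ k) Q) (shift-basis s<n (B₀-basis k<n))

    basis : Subset n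
    basis = proj₁ augmented

    is-basis : 𝓑 basis
    is-basis = proj₁ (proj₂ augmented)

    P : Subset n
    P = basis ─ B₀ k

    basis≡I∪P : basis ≡ I ∪ P
    basis≡I∪P = r≡[p─q]∪[r─p] W∩Q≡∅ (proj₁ (proj₂ (proj₂ augmented))) (proj₂ (proj₂ (proj₂ augmented)))

    P⊆W─B₀ : P ⊆ W ─ B₀ k
    P⊆W─B₀ = r⊆[p─q]∪w⇒r─p⊆w─p (proj₂ (proj₂ (proj₂ augmented)))

    r≤∣P∣ : r ≤ ∣ P ∣
    r≤∣P∣ = +-cancelˡ-≤ ∣ I ∣ r _ (begin
      ∣ I ∣ + r      ≡⟨ ∣I∣+r≡k ⟩
      k              ≡⟨ sym (rank basis is-basis) ⟩
      ∣ basis ∣      ≡⟨ cong ∣_∣ basis≡I∪P ⟩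
      ∣ I ∪ P ∣      ≤⟨ ∣p∪q∣≤∣p∣+∣q∣ I P ⟩
      ∣ I ∣ + ∣ P ∣  ∎)
      where open ≤-Reasoning

  bases-differ : ∀ {i i′} (d<i : d < i) (i≤n∸k : i ≤ n ∸ k) (d<i′ : d < i′) (i′≤n∸k : i′ ≤ n ∸ k) →
                 i + c ≤ i′ → Window.basis i d<i i≤n∸k ≢ Window.basis i′ d<i′ i′≤n∸k
  bases-differ {i} {i′} d<i i≤n∸k d<i′ i′≤n∸k gap same =
    <⇒≱ ∣P′∣<r V′.r≤∣P∣
    where
    module V  = Window i  d<i  i≤n∸k
    module V′ = Window i′ d<i′ i′≤n∸k
    k≡c+[r∸1] : k ≡ c + (r ∸ 1)
    k≡c+[r∸1] = sym (suc[m∸n]+[n∸1]≡m 0<r (subst (r ≤_) ∣I∣+r≡k (m≤n+m r ∣ I ∣)))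
    P′-range : ∀ {y} → y ∈ V′.P → V.s + c ≤ toℕ y × toℕ y < V.s + c + (r ∸ 1)
    P′-range {y} y∈P′ = lower , upper
      where
      lower : V.s + c ≤ toℕ y
      lower = ≤-trans (≤-trans (≤-reflexive (+-assoc (toℕ q₁) i c)) (+-monoʳ-≤ (toℕ q₁) gap))
                      (proj₁ (V′.W─B₀-range (V′.P⊆W─B₀ y∈P′)))
      y∈P : y ∈ V.P
      y∈P = subst (λ B → y ∈ B ─ B₀ k) (sym same) y∈P′
      upper : toℕ y < V.s + c + (r ∸ 1)
      upper = subst (toℕ y <_) (trans (cong (V.s +_) k≡c+[r∸1]) (sym (+-assoc V.s c (r ∸ 1))))
                    (proj₂ (V.W─B₀-range (V.P⊆W─B₀ y∈P)))
    ∣P′∣<r : ∣ V′.P ∣ < r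
    ∣P′∣<r = ≤-<-trans (within-interval⇒∣p∣≤l V′.P (V.s + c) (r ∸ 1) P′-range) (∸-monoʳ-< z<s 0<r)

proposition3p4 : (n k : ℕ) (𝓑 : Subset n → Set) → IsCyclicMatroid n k 𝓑 →
    (Q : Subset n) (q₁ q₂ : Fin n) →
    Q ⊆ B₀ k → q₁ ∈ Q → q₂ ∈ Q →
    (∀ q → q ∈ Q → toℕ q₁ ≤ toℕ q × toℕ q ≤ toℕ q₂) →
    toℕ q₂ ∸ toℕ q₁ < n ∸ k →
    let r = ∣ Q ∣
        m = (n ∸ k ∸ (toℕ q₂ ∸ toℕ q₁) ∸ 1) / suc (k ∸ r) + 1
    in ∃ λ (f : Fin m → Subset n) → Injective _≡_ _≡_ f ×
       (∀ j → 𝓑 (f j) ×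
          ∃ λ (i : ℕ) → toℕ q₂ ∸ toℕ q₁ < i × i ≤ n ∸ k ×
            ∃ λ (P : Subset n) → P ⊆ (Bint k (toℕ q₁ + i) ─ B₀ k) ×
              f j ≡ (B₀ k ─ Q) ∪ P)
proposition3p4 n k 𝓑 C Q q₁ q₂ Q⊆B₀ q₁∈Q _ Q-bounds d<n∸k =
  f , f-injective , λ j → let open Window (i j) (d<i j) (i≤n∸k j) in
    is-basis , i j , d<i j , i≤n∸k j , P , P⊆W─B₀ , basis≡I∪P
  where
  k<n : k < n
  k<n = m∸n≢0⇒n<m λ n∸k≡0 → n≮0 (subst (toℕ q₂ ∸ toℕ q₁ <_) n∸k≡0 d<n∸k)
  open Windows C k<n Q⊆B₀ q₁∈Q Q-bounds
  i : Fin (L / c + 1) → ℕ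
  i j = offset (toℕ j)
  d<i : ∀ j → d < i j
  d<i j = d<offset (toℕ j)
  i≤n∸k : ∀ j → i j ≤ n ∸ k
  i≤n∸k j = offset≤n∸k d<n∸k (m<1+n⇒m≤n (subst (toℕ j <_) (+-comm (L / c) 1) (toℕ<n j)))
  f : Fin (L / c + 1) → Subset n
  f j = Window.basis (i j) (d<i j) (i≤n∸k j)
  f-injective : Injective _≡_ _≡_ f
  f-injective {j} {j′} fj≡fj′ with <-cmp (toℕ j) (toℕ j′)
  ... | tri< j<j′ _ _ = ⊥-elim (bases-differ (d<i j) (i≤n∸k j) (d<i j′) (i≤n∸k j′) (offset-gap j<j′) fj≡fj′)
  ... | tri≈ _ j≡j′ _ = toℕ-injective j≡j′
  ... | tri> _ _ j′<j = ⊥-elim (bases-differ (d<i j′) (i≤n∸k j′) (d<i j) (i≤n∸k j) (offset-gap j′<j) (sym fj≡fj′))
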